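{- Let $\ell\in\mathbb{N}\cup\{0\}$. For integers $m\ge0$ and $N\ge1$, let $L_\ell(m,N)$ be the number of partitions of $N$ into $m$ parts whose largest part, say $n$, appears at least $n+\ell$ times, and let $R_\ell(k,N)$ be the number of generalized Rogers--Ramanujan partitions of $N$ associated with $\ell$ having rank $k$. Then $L_\ell(m,N)=R_\ell(m-1,N)$.
   Context: A generalized Rogers--Ramanujan partition of $N$ associated with $\ell$ is a partition of $N$ into parts all greater than $\ell$ in which any two parts differ by at least $2$. The rank of a partition is its largest part minus its number of parts. -}

module Defs where

open import Data.Nat using (ℕ; zero; suc; _+_; _≤_; _<_; _≥_; _⊔_)
open import Data.Nat using () renaming (_≟_ to _≟ℕ_)
open import Data.Integer using (ℤ; +_; _-_)
open import Data.List using (List; []; _∷_; length; foldr)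
open import Data.Nat.ListAction using (sum)
open import Data.List.Relation.Unary.All using (All)
open import Data.List.Relation.Unary.Linked using (Linked)
open import Data.Product using (_×_)
open import Relation.Binary.PropositionalEquality using (_≡_)
open import Relation.Nullary using (yes; no)

largest : List ℕ → ℕ
largest = foldr _⊔_ 0

occ : ℕ → List ℕ → ℕ
occ n [] = 0
occ n (x ∷ xs) with x ≟ℕ n
... | yes _ = suc (occ n xs)
... | no  _ = occ n xs

IsPartition : ℕ → List ℕ → Set
IsPartition N p = Linked _≥_ p × All (1 ≤_) p × sum p ≡ N

LPartition : ℕ → ℕ → ℕ → List ℕ → Set
LPartition ℓ m N p =
  IsPartition N p × length p ≡ m × largest p + ℓ ≤ occ (largest p) p

RRPartition : ℕ → ℕ → List ℕ → Set
RRPartition ℓ N p = Linked (λ a b → 2 + b ≤ a) p × All (ℓ <_) p × sum p ≡ N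

rank : List ℕ → ℤ
rank p = + largest p - + length p

RPartition : ℕ → ℤ → ℕ → List ℕ → Set
RPartition ℓ k N p = RRPartition ℓ N p × rank p ≡ k

module Submission where

open import Defs
open import Data.Nat using (ℕ; _≤_)
open import Data.Integer using (+_; _-_)
open import Data.List using (List)
open import Data.Product using (Σ)
open import Function.Bundles using (_↔_)

open import Data.Nat using (zero; suc; _+_; _*_; _∸_; _⊔_; _<_; _≥_; z≤n; s≤s)
open import Data.Nat.Properties
open import Data.Nat.ListAction using (sum)
open import Data.Nat.Tactic.RingSolver using (solve-∀)
open import Data.Integer using (-_; _⊖_)
import Data.Integer.Properties as ℤ
open import Data.List using ([]; _∷_; length)
open import Data.List.Relation.Unary.All as All using (All; []; _∷_)
open import Data.List.Relation.Unary.Linked as Linked using (Linked; []; [-]; _∷_)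
open import Data.List.Relation.Unary.Linked.Properties using (Linked⇒All)
open import Data.Product using (_×_; _,_)
open import Data.Product.Properties using (Σ-≡,≡→≡)
open import Data.Sum using (inj₁; inj₂)
open import Function.Base using (flip)
open import Function.Bundles using (mk↔ₛ′)
open import Function.Properties.Inverse using (↔-trans)
open import Relation.Binary.PropositionalEquality
open import Relation.Nullary using (Irrelevant; yes; no; contradiction)
open import Axiom.UniquenessOfIdentityProofs using (module Decidable⇒UIP)
open import Algebra.Properties.CommutativeSemigroup +-commutativeSemigroup using (x∙yz≈y∙xz)
open import Algebra.Properties.AbelianGroup ℤ.+-0-abelianGroup using (∙-cancelʳ)

-- Conjugation turns a partition whose largest part n occurs at least n + ℓ
-- times into a partition q₁ ≥ … ≥ q_k all of whose parts are at least k + ℓ,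
-- exchanging the number of parts with the largest part. Rebuilding q from its
-- gaps q₁ − q₂, …, q_{k−1} − q_k, q_k − (k + ℓ) with lower bound ℓ + 1 and
-- minimal difference 2 adds the staircase k − 1, k − 3, …, 1 − k to q: the sum
-- is unchanged, the result is a Rogers–Ramanujan partition associated with ℓ,
-- and its largest part q₁ + k − 1 gives it rank q₁ − 1.

-- Separated 0 is Linked _≥_ up to conversion, since 0 + b reduces to b.
Separated : ℕ → List ℕ → Set
Separated s = Linked (λ a b → s + b ≤ a)

smallest : List ℕ → ℕ
smallest [] = 0
smallest (x ∷ []) = x
smallest (_ ∷ y ∷ ys) = smallest (y ∷ ys)

Separated⇒decreasing : ∀ {s xs} → Separated s xs → Linked _≥_ xs
Separated⇒decreasing {s} = Linked.map (≤-trans (m≤n+m _ s))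

tail≤head : ∀ {x xs} → Linked _≥_ (x ∷ xs) → All (_≤ x) xs
tail≤head dec = All.tail (Linked⇒All (flip ≤-trans) ≤-refl dec)

∷-decreasing : ∀ {x xs} → All (_≤ x) xs → Linked _≥_ xs → Linked _≥_ (x ∷ xs)
∷-decreasing [] [] = [-]
∷-decreasing (y≤x ∷ _) dec = y≤x ∷ dec

largest≤ : ∀ {n xs} → All (_≤ n) xs → largest xs ≤ n
largest≤ [] = z≤n
largest≤ (x≤n ∷ xs≤n) = ⊔-lub x≤n (largest≤ xs≤n)

largest-head : ∀ {x xs} → Linked _≥_ (x ∷ xs) → largest (x ∷ xs) ≡ x
largest-head dec = m≥n⇒m⊔n≡m (largest≤ (tail≤head dec))

smallest-All : ∀ {P : ℕ → Set} xs → 1 ≤ length xs → All P xs → P (smallest xs)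
smallest-All (_ ∷ []) _ (px ∷ []) = px
smallest-All (_ ∷ ys@(_ ∷ _)) _ (_ ∷ pys) = smallest-All ys (s≤s z≤n) pys

≤smallest⇒All : ∀ {n xs} → Linked _≥_ xs → n ≤ smallest xs → All (n ≤_) xs
≤smallest⇒All [] _ = []
≤smallest⇒All [-] n≤x = n≤x ∷ []
≤smallest⇒All (x≥y ∷ dec) n≤ with ≤smallest⇒All dec n≤
... | n≤y ∷ rest = ≤-trans n≤y x≥y ∷ n≤y ∷ rest

positive-sum⇒nonempty : ∀ {N} xs → sum xs ≡ N → 1 ≤ N → 1 ≤ length xs
positive-sum⇒nonempty [] refl ()
positive-sum⇒nonempty (_ ∷ _) _ _ = s≤s z≤n

×-irrelevant : ∀ {A B : Set} → Irrelevant A → Irrelevant B → Irrelevant (A × B)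
×-irrelevant irrA irrB (a , b) (a′ , b′) = cong₂ _,_ (irrA a a′) (irrB b b′)

Σ-↔ : ∀ {A : Set} {P Q : A → Set} →
      (∀ {x} → Irrelevant (P x)) → (∀ {x} → Irrelevant (Q x)) →
      (f g : A → A) → (∀ {x} → P x → Q (f x)) → (∀ {x} → Q x → P (g x)) →
      (∀ {x} → P x → g (f x) ≡ x) → (∀ {x} → Q x → f (g x) ≡ x) →
      Σ A P ↔ Σ A Q
Σ-↔ P-irr Q-irr f g f-pres g-pres g∘f f∘g = mk↔ₛ′
  (λ (x , px) → f x , f-pres px) (λ (x , qx) → g x , g-pres qx)
  (λ (x , qx) → Σ-≡,≡→≡ (f∘g qx , Q-irr _ _))
  (λ (x , px) → Σ-≡,≡→≡ (g∘f px , P-irr _ _))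

Separated-irrelevant : ∀ {s xs} → Irrelevant (Separated s xs)
Separated-irrelevant = Linked.irrelevant ≤-irrelevant

All≥-irrelevant : ∀ {n xs} → Irrelevant (All (n ≤_) xs)
All≥-irrelevant = All.irrelevant ≤-irrelevant

IsPartition-irrelevant : ∀ {N p} → Irrelevant (IsPartition N p)
IsPartition-irrelevant =
  ×-irrelevant Separated-irrelevant (×-irrelevant All≥-irrelevant ≡-irrelevant)

LPartition-irrelevant : ∀ {ℓ m N p} → Irrelevant (LPartition ℓ m N p)
LPartition-irrelevant =
  ×-irrelevant IsPartition-irrelevant (×-irrelevant ≡-irrelevant ≤-irrelevant)

RPartition-irrelevant : ∀ {ℓ k N p} → Irrelevant (RPartition ℓ k N p)
RPartition-irrelevant =
  ×-irrelevant
    (×-irrelevant Separated-irrelevant (×-irrelevant All≥-irrelevant ≡-irrelevant))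
    (Decidable⇒UIP.≡-irrelevant ℤ._≟_)

-- Adding a first row of length n to a Ferrers diagram adds a cell to each of
-- its first n columns.
incrementPrefix : ℕ → List ℕ → List ℕ
incrementPrefix zero ys = ys
incrementPrefix (suc n) [] = 1 ∷ incrementPrefix n []
incrementPrefix (suc n) (y ∷ ys) = suc y ∷ incrementPrefix n ys

conjugate : List ℕ → List ℕ
conjugate [] = []
conjugate (x ∷ xs) = incrementPrefix x (conjugate xs)

length-incrementPrefix : ∀ n ys → length (incrementPrefix n ys) ≡ n ⊔ length ys
length-incrementPrefix zero ys = refl
length-incrementPrefix (suc n) [] = cong suc (trans (length-incrementPrefix n []) (⊔-identityʳ n))
length-incrementPrefix (suc n) (y ∷ ys) = cong suc (length-incrementPrefix n ys)

length-conjugate : ∀ p → length (conjugate p) ≡ largest p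
length-conjugate [] = refl
length-conjugate (x ∷ xs) =
  trans (length-incrementPrefix x (conjugate xs)) (cong (x ⊔_) (length-conjugate xs))

length-conjugate-head : ∀ {x xs} → Linked _≥_ (x ∷ xs) → length (conjugate (x ∷ xs)) ≡ x
length-conjugate-head {x} {xs} dec = trans (length-conjugate (x ∷ xs)) (largest-head dec)

length-conjugate-tail : ∀ {x xs} → Linked _≥_ (x ∷ xs) → length (conjugate xs) ≤ x
length-conjugate-tail {x} {xs} dec =
  subst (_≤ x) (sym (length-conjugate xs)) (largest≤ (tail≤head dec))

sum-incrementPrefix : ∀ n ys → length ys ≤ n → sum (incrementPrefix n ys) ≡ n + sum ys
sum-incrementPrefix zero [] _ = refl
sum-incrementPrefix (suc n) [] _ = cong suc (sum-incrementPrefix n [] z≤n)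
sum-incrementPrefix (suc n) (y ∷ ys) (s≤s len≤n) = begin
  suc y + sum (incrementPrefix n ys) ≡⟨ cong (_+_ (suc y)) (sum-incrementPrefix n ys len≤n) ⟩
  suc y + (n + sum ys)               ≡⟨ cong suc (x∙yz≈y∙xz y n (sum ys)) ⟩
  suc n + (y + sum ys)               ∎
  where open ≡-Reasoning

sum-conjugate : ∀ {p} → Linked _≥_ p → sum (conjugate p) ≡ sum p
sum-conjugate {[]} _ = refl
sum-conjugate {x ∷ xs} dec =
  trans (sum-incrementPrefix x (conjugate xs) (length-conjugate-tail dec))
        (cong (_+_ x) (sum-conjugate (Linked.tail dec)))

conjugate-incrementPrefix : ∀ n ys → length ys ≤ suc n →
                            conjugate (incrementPrefix (suc n) ys) ≡ suc n ∷ conjugate ys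
conjugate-incrementPrefix zero [] _ = refl
conjugate-incrementPrefix (suc n) [] _ = cong (incrementPrefix 1) (conjugate-incrementPrefix n [] z≤n)
conjugate-incrementPrefix zero (y ∷ []) _ = refl
conjugate-incrementPrefix zero (_ ∷ _ ∷ _) (s≤s ())
conjugate-incrementPrefix (suc n) (y ∷ ys) (s≤s len≤n) =
  cong (incrementPrefix (suc y)) (conjugate-incrementPrefix n ys len≤n)

conjugate-involutive : ∀ {p} → Linked _≥_ p → All (1 ≤_) p → conjugate (conjugate p) ≡ p
conjugate-involutive {[]} _ _ = refl
conjugate-involutive {suc x ∷ xs} dec (_ ∷ pos) =
  trans (conjugate-incrementPrefix x (conjugate xs) (length-conjugate-tail dec))
        (cong (suc x ∷_) (conjugate-involutive (Linked.tail dec) pos))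

incrementPrefix-≤ : ∀ {k} n ys → All (_≤ k) ys → All (_≤ suc k) (incrementPrefix n ys)
incrementPrefix-≤ zero ys ys≤k = All.map m≤n⇒m≤1+n ys≤k
incrementPrefix-≤ (suc n) [] [] = s≤s z≤n ∷ incrementPrefix-≤ n [] []
incrementPrefix-≤ (suc n) (y ∷ ys) (y≤k ∷ ys≤k) = s≤s y≤k ∷ incrementPrefix-≤ n ys ys≤k

incrementPrefix-decreasing : ∀ n ys → Linked _≥_ ys → Linked _≥_ (incrementPrefix n ys)
incrementPrefix-decreasing zero ys dec = dec
incrementPrefix-decreasing (suc n) [] _ =
  ∷-decreasing (incrementPrefix-≤ n [] []) (incrementPrefix-decreasing n [] [])
incrementPrefix-decreasing (suc n) (y ∷ ys) dec =
  ∷-decreasing (incrementPrefix-≤ n ys (tail≤head dec)) (incrementPrefix-decreasing n ys (Linked.tail dec))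

incrementPrefix-positive : ∀ n ys → All (1 ≤_) ys → All (1 ≤_) (incrementPrefix n ys)
incrementPrefix-positive zero ys pos = pos
incrementPrefix-positive (suc n) [] [] = s≤s z≤n ∷ incrementPrefix-positive n [] []
incrementPrefix-positive (suc n) (y ∷ ys) (_ ∷ pos) = s≤s z≤n ∷ incrementPrefix-positive n ys pos

conjugate-decreasing : ∀ p → Linked _≥_ (conjugate p)
conjugate-decreasing [] = []
conjugate-decreasing (x ∷ xs) = incrementPrefix-decreasing x (conjugate xs) (conjugate-decreasing xs)

conjugate-positive : ∀ p → All (1 ≤_) (conjugate p)
conjugate-positive [] = []
conjugate-positive (x ∷ xs) = incrementPrefix-positive x (conjugate xs) (conjugate-positive xs)

occ-head : ∀ n xs → occ n (n ∷ xs) ≡ suc (occ n xs)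
occ-head n xs with n ≟ n
... | yes _ = refl
... | no n≢n = contradiction refl n≢n

occ-absent : ∀ {n xs} → All (_< n) xs → occ n xs ≡ 0
occ-absent [] = refl
occ-absent {n} {x ∷ _} (x<n ∷ xs<n) with x ≟ n
... | yes refl = contradiction x<n (<-irrefl refl)
... | no _ = occ-absent xs<n

smallest-incrementPrefix-< : ∀ n ys → length ys < n → smallest (incrementPrefix n ys) ≡ 1
smallest-incrementPrefix-< (suc zero) [] _ = refl
smallest-incrementPrefix-< (suc (suc n)) [] _ = smallest-incrementPrefix-< (suc n) [] (s≤s z≤n)
smallest-incrementPrefix-< (suc (suc n)) (_ ∷ []) _ = smallest-incrementPrefix-< (suc n) [] (s≤s z≤n)
smallest-incrementPrefix-< (suc (suc n)) (_ ∷ y ∷ ys) (s≤s len<n) =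
  smallest-incrementPrefix-< (suc n) (y ∷ ys) len<n
smallest-incrementPrefix-< (suc zero) (_ ∷ _) (s≤s ())

smallest-incrementPrefix-length : ∀ ys → 1 ≤ length ys →
                                  smallest (incrementPrefix (length ys) ys) ≡ suc (smallest ys)
smallest-incrementPrefix-length (_ ∷ []) _ = refl
smallest-incrementPrefix-length (_ ∷ y ∷ ys) _ = smallest-incrementPrefix-length (y ∷ ys) (s≤s z≤n)

smallest-conjugate-head : ∀ {x xs} → Linked _≥_ (x ∷ xs) → All (1 ≤_) (x ∷ xs) →
                          smallest (conjugate (x ∷ xs)) ≡ occ x (x ∷ xs)
smallest-conjugate-head {x} {[]} _ (1≤x ∷ []) =
  trans (smallest-incrementPrefix-< x [] 1≤x) (sym (occ-head x []))
smallest-conjugate-head {x} {y ∷ ys} (y≤x ∷ dec) (1≤x ∷ pos) with m≤n⇒m<n∨m≡n y≤x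
... | inj₁ y<x = begin
  smallest (incrementPrefix x (conjugate (y ∷ ys)))
    ≡⟨ smallest-incrementPrefix-< x _ (subst (_< x) (sym (length-conjugate-head dec)) y<x) ⟩
  1
    ≡⟨ cong suc (sym (occ-absent (y<x ∷ All.map (λ z≤y → ≤-<-trans z≤y y<x) (tail≤head dec)))) ⟩
  suc (occ x (y ∷ ys))
    ≡⟨ sym (occ-head x (y ∷ ys)) ⟩
  occ x (x ∷ y ∷ ys) ∎
  where open ≡-Reasoning
... | inj₂ refl = begin
  smallest (incrementPrefix x (conjugate (x ∷ ys)))
    ≡⟨ cong (λ n → smallest (incrementPrefix n (conjugate (x ∷ ys))))
            (sym (length-conjugate-head dec)) ⟩
  smallest (incrementPrefix (length (conjugate (x ∷ ys))) (conjugate (x ∷ ys)))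
    ≡⟨ smallest-incrementPrefix-length (conjugate (x ∷ ys))
         (subst (1 ≤_) (sym (length-conjugate-head dec)) 1≤x) ⟩
  suc (smallest (conjugate (x ∷ ys)))
    ≡⟨ cong suc (smallest-conjugate-head dec pos) ⟩
  suc (occ x (x ∷ ys))
    ≡⟨ sym (occ-head x (x ∷ ys)) ⟩
  occ x (x ∷ x ∷ ys) ∎
  where open ≡-Reasoning

smallest-conjugate : ∀ {p} → Linked _≥_ p → All (1 ≤_) p →
                     smallest (conjugate p) ≡ occ (largest p) p
smallest-conjugate {[]} _ _ = refl
smallest-conjugate {x ∷ xs} dec pos =
  trans (smallest-conjugate-head dec pos) (cong (λ n → occ n (x ∷ xs)) (sym (largest-head dec)))

conjugate-IsPartition : ∀ {N p} → IsPartition N p → IsPartition N (conjugate p)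
conjugate-IsPartition {p = p} (dec , _ , sum≡N) =
  conjugate-decreasing p , conjugate-positive p , trans (sum-conjugate dec) sum≡N

largest-conjugate : ∀ {N p} → IsPartition N p → largest (conjugate p) ≡ length p
largest-conjugate {p = p} (dec , pos , _) =
  trans (sym (length-conjugate (conjugate p))) (cong length (conjugate-involutive dec pos))

ConjugateLPartition : ℕ → ℕ → ℕ → List ℕ → Set
ConjugateLPartition ℓ m N q = IsPartition N q × largest q ≡ m × length q + ℓ ≤ smallest q

ConjugateLPartition-irrelevant : ∀ {ℓ m N q} → Irrelevant (ConjugateLPartition ℓ m N q)
ConjugateLPartition-irrelevant =
  ×-irrelevant IsPartition-irrelevant (×-irrelevant ≡-irrelevant ≤-irrelevant)

conjugate-LPartition : ∀ {ℓ m N p} → LPartition ℓ m N p → ConjugateLPartition ℓ m N (conjugate p)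
conjugate-LPartition {ℓ} {p = p} (part@(dec , pos , _) , length≡m , multiplicity) =
  conjugate-IsPartition part ,
  trans (largest-conjugate part) length≡m ,
  subst₂ (λ a b → a + ℓ ≤ b) (sym (length-conjugate p)) (sym (smallest-conjugate dec pos)) multiplicity

conjugate-ConjugateLPartition : ∀ {ℓ m N q} → ConjugateLPartition ℓ m N q →
                                LPartition ℓ m N (conjugate q)
conjugate-ConjugateLPartition {ℓ} {q = q} (part@(dec , pos , _) , largest≡m , bound) =
  conjugate-IsPartition part ,
  trans (length-conjugate q) largest≡m ,
  subst₂ (λ a b → a + ℓ ≤ b) (sym (largest-conjugate part)) smallest≡occ bound
  where
  smallest≡occ : smallest q ≡ occ (largest (conjugate q)) (conjugate q)
  smallest≡occ = trans (cong smallest (sym (conjugate-involutive dec pos)))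
                       (smallest-conjugate (conjugate-decreasing q) (conjugate-positive q))

LPartition↔ConjugateLPartition : ∀ ℓ m N →
  Σ (List ℕ) (LPartition ℓ m N) ↔ Σ (List ℕ) (ConjugateLPartition ℓ m N)
LPartition↔ConjugateLPartition ℓ m N =
  Σ-↔ LPartition-irrelevant ConjugateLPartition-irrelevant conjugate conjugate
      conjugate-LPartition conjugate-ConjugateLPartition
      (λ ((dec , pos , _) , _) → conjugate-involutive dec pos)
      (λ ((dec , pos , _) , _) → conjugate-involutive dec pos)

-- the least entry that may be put in front of qs in an s-separated list
-- whose entries are at least b
floor : ℕ → ℕ → List ℕ → ℕ
floor b s [] = b
floor b s (q ∷ _) = s + q

fromGaps : ℕ → ℕ → List ℕ → List ℕ
fromGaps b s [] = []
fromGaps b s (d ∷ ds) = d + floor b s (fromGaps b s ds) ∷ fromGaps b s ds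

toGaps : ℕ → ℕ → List ℕ → List ℕ
toGaps b s [] = []
toGaps b s (q ∷ qs) = q ∸ floor b s qs ∷ toGaps b s qs

length-fromGaps : ∀ b s ds → length (fromGaps b s ds) ≡ length ds
length-fromGaps b s [] = refl
length-fromGaps b s (d ∷ ds) = cong suc (length-fromGaps b s ds)

length-toGaps : ∀ b s qs → length (toGaps b s qs) ≡ length qs
length-toGaps b s [] = refl
length-toGaps b s (q ∷ qs) = cong suc (length-toGaps b s qs)

floor-fromGaps : ∀ b s ds → floor b s (fromGaps b s ds) ≡ b + s * length ds + sum ds
floor-fromGaps b s [] = identity b s
  where
  identity : ∀ b s → b ≡ b + s * 0 + 0
  identity = solve-∀
floor-fromGaps b s (d ∷ ds) =
  trans (cong (λ f → s + (d + f)) (floor-fromGaps b s ds)) (rearrange d b s (length ds) (sum ds))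
  where
  rearrange : ∀ d b s L S → s + (d + (b + s * L + S)) ≡ b + s * (1 + L) + (d + S)
  rearrange = solve-∀

b≤floor-fromGaps : ∀ b s ds → b ≤ floor b s (fromGaps b s ds)
b≤floor-fromGaps b s [] = ≤-refl
b≤floor-fromGaps b s (d ∷ ds) =
  ≤-trans (b≤floor-fromGaps b s ds) (≤-trans (m≤n+m _ d) (m≤n+m _ s))

fromGaps-bounded : ∀ b s ds → All (b ≤_) (fromGaps b s ds)
fromGaps-bounded b s [] = []
fromGaps-bounded b s (d ∷ ds) =
  ≤-trans (b≤floor-fromGaps b s ds) (m≤n+m _ d) ∷ fromGaps-bounded b s ds

fromGaps-separated : ∀ b s ds → Separated s (fromGaps b s ds)
fromGaps-separated b s [] = []
fromGaps-separated b s (d ∷ []) = [-]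
fromGaps-separated b s (d ∷ ds@(_ ∷ _)) = m≤n+m _ d ∷ fromGaps-separated b s ds

toGaps-fromGaps : ∀ b s ds → toGaps b s (fromGaps b s ds) ≡ ds
toGaps-fromGaps b s [] = refl
toGaps-fromGaps b s (d ∷ ds) =
  cong₂ _∷_ (m+n∸n≡m d (floor b s (fromGaps b s ds))) (toGaps-fromGaps b s ds)

fromGaps-toGaps : ∀ {b s} qs → Separated s qs → All (b ≤_) qs → fromGaps b s (toGaps b s qs) ≡ qs
fromGaps-toGaps [] _ _ = refl
fromGaps-toGaps (q ∷ []) _ (b≤q ∷ []) = cong (_∷ []) (m∸n+n≡m b≤q)
fromGaps-toGaps {b} {s} (q ∷ qs@(q′ ∷ _)) (gap ∷ sep) (_ ∷ bounded) =
  cong₂ _∷_ (trans (cong (λ f → q ∸ (s + q′) + floor b s f) tail≡) (m∸n+n≡m gap)) tail≡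
  where
  tail≡ : fromGaps b s (toGaps b s qs) ≡ qs
  tail≡ = fromGaps-toGaps qs sep bounded

largest-fromGaps : ∀ b s d ds → largest (fromGaps b s (d ∷ ds)) ≡ d + (b + s * length ds + sum ds)
largest-fromGaps b s d ds =
  trans (largest-head (Separated⇒decreasing (fromGaps-separated b s (d ∷ ds))))
        (cong (_+_ d) (floor-fromGaps b s ds))

sum-fromGaps-suc : ∀ b s ds → sum (fromGaps (suc b) s ds) ≡ length ds + sum (fromGaps b s ds)
sum-fromGaps-suc b s [] = refl
sum-fromGaps-suc b s (d ∷ ds) = begin
  d + floor (suc b) s (fromGaps (suc b) s ds) + sum (fromGaps (suc b) s ds)
    ≡⟨ cong₂ (λ f t → d + f + t) (floor-fromGaps (suc b) s ds) (sum-fromGaps-suc b s ds) ⟩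
  d + (suc b + s * L + S) + (L + T)
    ≡⟨ rearrange d b s L S T ⟩
  suc L + (d + (b + s * L + S) + T)
    ≡⟨ cong (λ f → suc L + (d + f + T)) (sym (floor-fromGaps b s ds)) ⟩
  suc L + sum (fromGaps b s (d ∷ ds)) ∎
  where
  open ≡-Reasoning
  L = length ds
  S = sum ds
  T = sum (fromGaps b s ds)
  rearrange : ∀ d b s L S T → d + (1 + b + s * L + S) + (L + T) ≡ 1 + L + (d + (b + s * L + S) + T)
  rearrange = solve-∀

sum-fromGaps-staircase : ∀ x s ds → sum (fromGaps (length ds + x) s ds) ≡ sum (fromGaps (suc x) (2 + s) ds)
sum-fromGaps-staircase x s [] = refl
sum-fromGaps-staircase x s (d ∷ ds) = begin
  d + floor (suc (L + x)) s (fromGaps (suc (L + x)) s ds) + sum (fromGaps (suc (L + x)) s ds)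
    ≡⟨ cong₂ (λ f t → d + f + t) (floor-fromGaps (suc (L + x)) s ds) (sum-fromGaps-suc (L + x) s ds) ⟩
  d + (suc (L + x) + s * L + S) + (L + sum (fromGaps (L + x) s ds))
    ≡⟨ cong (λ t → d + (suc (L + x) + s * L + S) + (L + t)) (sum-fromGaps-staircase x s ds) ⟩
  d + (suc (L + x) + s * L + S) + (L + T)
    ≡⟨ rearrange d x s L S T ⟩
  d + (suc x + (2 + s) * L + S) + T
    ≡⟨ cong (λ f → d + f + T) (sym (floor-fromGaps (suc x) (2 + s) ds)) ⟩
  sum (fromGaps (suc x) (2 + s) (d ∷ ds)) ∎
  where
  open ≡-Reasoning
  L = length ds
  S = sum ds
  T = sum (fromGaps (suc x) (2 + s) ds)
  rearrange : ∀ d x s L S T →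
              d + (1 + (L + x) + s * L + S) + (L + T) ≡ d + (1 + x + (2 + s) * L + S) + T
  rearrange = solve-∀

+[m+n]-+[m+o]≡+n-+o : ∀ m n o → + (m + n) - + (m + o) ≡ + n - + o
+[m+n]-+[m+o]≡+n-+o m n o = begin
  + (m + n) - + (m + o) ≡⟨ ℤ.[+m]-[+n]≡m⊖n (m + n) (m + o) ⟩
  (m + n) ⊖ (m + o)     ≡⟨ ℤ.+-cancelˡ-⊖ m n o ⟩
  n ⊖ o                 ≡⟨ ℤ.[+m]-[+n]≡m⊖n n o ⟨
  + n - + o             ∎
  where open ≡-Reasoning

+m-1-injective : ∀ {m n} → + m - + 1 ≡ + n - + 1 → m ≡ n
+m-1-injective {m} {n} eq = ℤ.+-injective (∙-cancelʳ (- + 1) (+ m) (+ n) eq)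

rank-fromGaps-staircase : ∀ x s ds → 1 ≤ length ds →
  rank (fromGaps (suc x) (2 + s) ds) ≡ + largest (fromGaps (length ds + x) s ds) - + 1
rank-fromGaps-staircase x s (d ∷ ds) _ = begin
  + largest (fromGaps (suc x) (2 + s) (d ∷ ds)) - + length (fromGaps (suc x) (2 + s) (d ∷ ds))
    ≡⟨ cong₂ (λ a k → + a - + k) (largest-fromGaps (suc x) (2 + s) d ds)
                                 (length-fromGaps (suc x) (2 + s) (d ∷ ds)) ⟩
  + (d + (suc x + (2 + s) * L + S)) - + suc L
    ≡⟨ cong₂ (λ a k → + a - + k) (rearrange d x s L S) (+-comm 1 L) ⟩
  + (L + (d + (suc L + x + s * L + S))) - + (L + 1)
    ≡⟨ +[m+n]-+[m+o]≡+n-+o L _ 1 ⟩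
  + (d + (suc L + x + s * L + S)) - + 1
    ≡⟨ cong (λ a → + a - + 1) (sym (largest-fromGaps (suc L + x) s d ds)) ⟩
  + largest (fromGaps (suc L + x) s (d ∷ ds)) - + 1 ∎
  where
  open ≡-Reasoning
  L = length ds
  S = sum ds
  rearrange : ∀ d x s L S → d + (1 + x + (2 + s) * L + S) ≡ L + (d + (1 + L + x + s * L + S))
  rearrange = solve-∀

addStaircase : ℕ → List ℕ → List ℕ
addStaircase ℓ q = fromGaps (suc ℓ) 2 (toGaps (length q + ℓ) 0 q)

removeStaircase : ℕ → List ℕ → List ℕ
removeStaircase ℓ r = fromGaps (length r + ℓ) 0 (toGaps (suc ℓ) 2 r)

length-addStaircase : ∀ ℓ q → length (addStaircase ℓ q) ≡ length q
length-addStaircase ℓ q =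
  trans (length-fromGaps (suc ℓ) 2 (toGaps (length q + ℓ) 0 q)) (length-toGaps (length q + ℓ) 0 q)

length-removeStaircase : ∀ ℓ r → length (removeStaircase ℓ r) ≡ length r
length-removeStaircase ℓ r =
  trans (length-fromGaps (length r + ℓ) 0 (toGaps (suc ℓ) 2 r)) (length-toGaps (suc ℓ) 2 r)

removeStaircase-addStaircase : ∀ {ℓ q} → Linked _≥_ q → length q + ℓ ≤ smallest q →
                               removeStaircase ℓ (addStaircase ℓ q) ≡ q
removeStaircase-addStaircase {ℓ} {q} dec bound = begin
  fromGaps (length (addStaircase ℓ q) + ℓ) 0 (toGaps (suc ℓ) 2 (fromGaps (suc ℓ) 2 ds))
    ≡⟨ cong₂ (λ k gs → fromGaps (k + ℓ) 0 gs)
             (length-addStaircase ℓ q) (toGaps-fromGaps (suc ℓ) 2 ds) ⟩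
  fromGaps (length q + ℓ) 0 ds
    ≡⟨ fromGaps-toGaps q dec (≤smallest⇒All dec bound) ⟩
  q ∎
  where
  open ≡-Reasoning
  ds = toGaps (length q + ℓ) 0 q

addStaircase-removeStaircase : ∀ {ℓ r} → Separated 2 r → All (ℓ <_) r →
                               addStaircase ℓ (removeStaircase ℓ r) ≡ r
addStaircase-removeStaircase {ℓ} {r} sep bounded = begin
  fromGaps (suc ℓ) 2 (toGaps (length (removeStaircase ℓ r) + ℓ) 0 (fromGaps (length r + ℓ) 0 ds))
    ≡⟨ cong (λ k → fromGaps (suc ℓ) 2 (toGaps (k + ℓ) 0 (fromGaps (length r + ℓ) 0 ds)))
            (length-removeStaircase ℓ r) ⟩
  fromGaps (suc ℓ) 2 (toGaps (length r + ℓ) 0 (fromGaps (length r + ℓ) 0 ds))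
    ≡⟨ cong (fromGaps (suc ℓ) 2) (toGaps-fromGaps (length r + ℓ) 0 ds) ⟩
  fromGaps (suc ℓ) 2 ds
    ≡⟨ fromGaps-toGaps r sep bounded ⟩
  r ∎
  where
  open ≡-Reasoning
  ds = toGaps (suc ℓ) 2 r

addStaircase-RPartition : ∀ {ℓ m N q} → 1 ≤ N → ConjugateLPartition ℓ m N q →
                          RPartition ℓ (+ m - + 1) N (addStaircase ℓ q)
addStaircase-RPartition {ℓ} {m} {N} {q} N≥1 ((dec , _ , sum≡N) , largest≡m , bound) =
  (fromGaps-separated (suc ℓ) 2 ds , fromGaps-bounded (suc ℓ) 2 ds , sum≡N′) , rank≡
  where
  open ≡-Reasoning
  ds = toGaps (length q + ℓ) 0 q
  q≡ : fromGaps (length ds + ℓ) 0 ds ≡ q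
  q≡ = trans (cong (λ k → fromGaps (k + ℓ) 0 ds) (length-toGaps (length q + ℓ) 0 q))
             (fromGaps-toGaps q dec (≤smallest⇒All dec bound))
  sum≡N′ : sum (fromGaps (suc ℓ) 2 ds) ≡ N
  sum≡N′ = begin
    sum (fromGaps (suc ℓ) 2 ds)          ≡⟨ sum-fromGaps-staircase ℓ 0 ds ⟨
    sum (fromGaps (length ds + ℓ) 0 ds)  ≡⟨ cong sum q≡ ⟩
    sum q                                ≡⟨ sum≡N ⟩
    N                                    ∎
  rank≡ : rank (fromGaps (suc ℓ) 2 ds) ≡ + m - + 1
  rank≡ = begin
    rank (fromGaps (suc ℓ) 2 ds)
      ≡⟨ rank-fromGaps-staircase ℓ 0 ds (subst (1 ≤_) (sym (length-toGaps (length q + ℓ) 0 q))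
                                                   (positive-sum⇒nonempty q sum≡N N≥1)) ⟩
    + largest (fromGaps (length ds + ℓ) 0 ds) - + 1
      ≡⟨ cong (λ p → + largest p - + 1) q≡ ⟩
    + largest q - + 1
      ≡⟨ cong (λ a → + a - + 1) largest≡m ⟩
    + m - + 1 ∎

removeStaircase-ConjugateLPartition : ∀ {ℓ m N r} → 1 ≤ N → RPartition ℓ (+ m - + 1) N r →
                                      ConjugateLPartition ℓ m N (removeStaircase ℓ r)
removeStaircase-ConjugateLPartition {ℓ} {m} {N} {r} N≥1 ((sep , bounded , sum≡N) , rank≡) =
  (fromGaps-separated (length r + ℓ) 0 ds , All.map (≤-trans 1≤length+ℓ) q-bounded , sum≡N′) ,
  largest≡m ,
  subst (λ k → k + ℓ ≤ smallest q) (sym (length-removeStaircase ℓ r))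
        (smallest-All q (subst (1 ≤_) (sym (length-removeStaircase ℓ r)) r-nonempty) q-bounded)
  where
  open ≡-Reasoning
  ds = toGaps (suc ℓ) 2 r
  q = removeStaircase ℓ r
  r-nonempty : 1 ≤ length r
  r-nonempty = positive-sum⇒nonempty r sum≡N N≥1
  1≤length+ℓ : 1 ≤ length r + ℓ
  1≤length+ℓ = ≤-trans r-nonempty (m≤m+n (length r) ℓ)
  q-bounded : All (length r + ℓ ≤_) q
  q-bounded = fromGaps-bounded (length r + ℓ) 0 ds
  q≡ : q ≡ fromGaps (length ds + ℓ) 0 ds
  q≡ = cong (λ k → fromGaps (k + ℓ) 0 ds) (sym (length-toGaps (suc ℓ) 2 r))
  r≡ : fromGaps (suc ℓ) 2 ds ≡ r
  r≡ = fromGaps-toGaps r sep bounded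
  sum≡N′ : sum q ≡ N
  sum≡N′ = begin
    sum q                                ≡⟨ cong sum q≡ ⟩
    sum (fromGaps (length ds + ℓ) 0 ds)  ≡⟨ sum-fromGaps-staircase ℓ 0 ds ⟩
    sum (fromGaps (suc ℓ) 2 ds)          ≡⟨ cong sum r≡ ⟩
    sum r                                ≡⟨ sum≡N ⟩
    N                                    ∎
  largest≡m : largest q ≡ m
  largest≡m = +m-1-injective (begin
    + largest q - + 1
      ≡⟨ cong (λ p → + largest p - + 1) q≡ ⟩
    + largest (fromGaps (length ds + ℓ) 0 ds) - + 1
      ≡⟨ rank-fromGaps-staircase ℓ 0 ds (subst (1 ≤_) (sym (length-toGaps (suc ℓ) 2 r)) r-nonempty) ⟨
    rank (fromGaps (suc ℓ) 2 ds)
      ≡⟨ cong rank r≡ ⟩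
    rank r
      ≡⟨ rank≡ ⟩
    + m - + 1 ∎)

ConjugateLPartition↔RPartition : ∀ ℓ m N → 1 ≤ N →
  Σ (List ℕ) (ConjugateLPartition ℓ m N) ↔ Σ (List ℕ) (RPartition ℓ (+ m - + 1) N)
ConjugateLPartition↔RPartition ℓ m N N≥1 =
  Σ-↔ ConjugateLPartition-irrelevant RPartition-irrelevant (addStaircase ℓ) (removeStaircase ℓ)
      (addStaircase-RPartition N≥1) (removeStaircase-ConjugateLPartition N≥1)
      (λ ((dec , _) , _ , bound) → removeStaircase-addStaircase dec bound)
      (λ ((sep , bounded , _) , _) → addStaircase-removeStaircase sep bounded)

theorem4p2 : (ℓ m N : ℕ) → 1 ≤ N →
    Σ (List ℕ) (LPartition ℓ m N) ↔ Σ (List ℕ) (RPartition ℓ (+ m - + 1) N)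
theorem4p2 ℓ m N N≥1 =
  ↔-trans (LPartition↔ConjugateLPartition ℓ m N) (ConjugateLPartition↔RPartition ℓ m N N≥1)
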